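{- For every integer $k \ge 1$, with $n = 3^k$, there exists a Kirkman triple system $(\mathcal{S},\mathcal{B})$ of order $n$ on the point set $\mathcal{S}=\{0,1,\dots,n-1\}$ with $\min_\Sigma(\mathcal{B}) = n$ (the maximum possible min-sum).
   Context: A Steiner triple system of order $n$ is a pair $(\mathcal{S},\mathcal{B})$ where $\mathcal{S}$ is a set of $n$ elements and $\mathcal{B}$ is a set of 3-element subsets of $\mathcal{S}$ (blocks) such that every 2-element subset of $\mathcal{S}$ is contained in exactly one block. A parallel class is a subset of $\mathcal{B}$ that partitions $\mathcal{S}$; the system is resolvable if $\mathcal{B}$ can be partitioned into parallel classes. A Kirkman triple system of order $n$ is a resolvable Steiner triple system of order $n$. For a design with $\mathcal{S}=\{0,1,\dots,n-1\}$, the min-sum is $\min_\Sigma(\mathcal{B}) := \min_{B\in\mathcal{B}} \sum_{x\in B} x$; for Steiner triple systems of order $n$ this is always at most $n$. -}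

module Defs where

open import Data.Nat using (ℕ; _+_; _≤_; _<_; _^_)
open import Data.Fin using (Fin; toℕ)
open import Data.List using (List; length; lookup; concat)
open import Data.List.Membership.Propositional using (_∈_)
open import Data.List.Relation.Binary.Permutation.Propositional using (_↭_)
open import Data.Product using (Σ; ∃; _×_; _,_)
open import Data.Sum using (_⊎_)
open import Relation.Binary.PropositionalEquality using (_≡_)
open import Relation.Nullary using (¬_)

-- A block is a 3-element subset {a,b,c} of S = {0,…,n-1}, stored in
-- increasing order a < b < c (so each 3-subset has a unique representation).
record Block (n : ℕ) : Set where
  constructor block
  field
    a b c : Fin n
    a<b   : toℕ a < toℕ b
    b<c   : toℕ b < toℕ c
open Block public

_∈B_ : ∀ {n} → Fin n → Block n → Set
x ∈B B = x ≡ a B ⊎ x ≡ b B ⊎ x ≡ c B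

blockSum : ∀ {n} → Block n → ℕ
blockSum B = toℕ (a B) + toℕ (b B) + toℕ (c B)

ExactlyOne : ∀ {A : Set} → (A → Set) → List A → Set
ExactlyOne P xs =
  Σ (Fin (length xs)) λ i → P (lookup xs i) ×
    (∀ (j : Fin (length xs)) → P (lookup xs j) → j ≡ i)

IsSTS : (n : ℕ) → List (Block n) → Set
IsSTS n ℬ = ∀ (x y : Fin n) → ¬ (x ≡ y) →
  ExactlyOne (λ B → x ∈B B × y ∈B B) ℬ

IsParallelClass : (n : ℕ) → List (Block n) → Set
IsParallelClass n P = ∀ (x : Fin n) → ExactlyOne (λ B → x ∈B B) P

IsResolvable : (n : ℕ) → List (Block n) → Set
IsResolvable n ℬ = Σ (List (List (Block n))) λ R →
  (concat R ↭ ℬ) × (∀ P → P ∈ R → IsParallelClass n P)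

IsKTS : (n : ℕ) → List (Block n) → Set
IsKTS n ℬ = IsSTS n ℬ × IsResolvable n ℬ

IsMinSum : ∀ {n} → List (Block n) → ℕ → Set
IsMinSum ℬ m = (∀ B → B ∈ ℬ → m ≤ blockSum B) × (∃ λ B → B ∈ ℬ × blockSum B ≡ m)

-- Induction on k by tripling.  The points of order 9m are written combine i x = 3m·i + x with
-- a top digit i < 3 and a point x of a Kirkman system of order 3m.  The new parallel classes are
-- the columns {x, 3m + x, 6m + x} and, for each old class and each s ∈ ℤ/3, the blocks obtained
-- from every old block {x₀, x₁, x₂} of that class by giving xₑ the top digit j + e·s + e(e − 1)
-- (mod 3), one block for each j ∈ ℤ/3.  Two points of one column lie in no other block; two
-- points with distinct lower parts x ≠ y lie in the old block through x and y, whose class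
-- and position then determine s and j.  The top digits of a new block sum to at least 2, so its
-- sum is at least 2·3m + 3m = 9m, attained by the minimal old block with top digits (0, 0, 2).
module Submission where

open import Defs
open import Data.Nat using (ℕ; zero; suc; _+_; _*_; _∸_; _^_; _≤_; _≤?_)
open import Data.Nat.Properties
  using (module ≤-Reasoning; +-commutativeSemigroup; ≤-refl; ≤-trans; ≤-reflexive;
         +-mono-≤; *-monoʳ-≤; m≤m+n; *-comm)
open import Algebra.Properties.CommutativeSemigroup +-commutativeSemigroup using (xy∙z≈yx∙z; xy∙z≈xz∙y)
open import Data.Nat.DivMod using (_mod_)
open import Data.Nat.Tactic.RingSolver using (solve-∀)
open import Data.Fin using (Fin; zero; suc; toℕ; _<_; combine; remQuot)
open import Data.Fin.Properties
  using (_≟_; all?; <-cmp; toℕ-combine; remQuot-combine; combine-remQuot;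
         combine-injectiveˡ; combine-injectiveʳ)
open import Data.List using (List; []; _∷_; _++_; map; concat; allFin; cartesianProduct)
open import Data.List.Properties using (map-++; map-∘)
open import Data.List.Membership.Propositional using (_∈_)
open import Data.List.Membership.Propositional.Properties
  using (∈-map⁺; ∈-map⁻; ∈-lookup; ∈-allFin; ∈-cartesianProduct⁺)
open import Data.List.Relation.Unary.All as All using (All)
import Data.List.Relation.Unary.All.Properties as All
open import Data.List.Relation.Unary.Any as Any using (here; there)
open import Data.List.Relation.Unary.Unique.Propositional using (Unique; _∷_)
import Data.List.Relation.Unary.Unique.Propositional.Properties as Unique
open import Data.List.Relation.Binary.Permutation.Propositional using (↭-reflexive)
open import Data.Maybe using (Maybe; nothing; just)
open import Data.Maybe.Properties using (just-injective)
open import Data.Product using (Σ; ∃; ∃₂; ∃!; _×_; _,_; proj₁; proj₂; map₂; uncurry)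
open import Data.Product.Properties using (≡-dec)
open import Data.Sum as Sum using (_⊎_; inj₁; inj₂)
open import Data.Empty using (⊥-elim)
open import Function.Construct.Composition using (_⇔-∘_)
open import Data.Product.Function.NonDependent.Propositional using (_×-⇔_)
open import Function using (id; _∘_; _⇔_; Equivalence; mk⇔; Injective)
open import Relation.Binary.PropositionalEquality
open import Relation.Binary.Definitions using (DecidableEquality; tri<; tri≈; tri>)
open import Relation.Nullary using (¬_; Dec; yes; no)
open import Relation.Nullary.Decidable using (map′; toWitness; ¬?; _×-dec_; _→-dec_)
open import Relation.Unary using (Decidable)

record Enumeration (A : Set) : Set where
  field
    elements : List A
    unique   : Unique elements
    complete : ∀ a → a ∈ elements
open Enumeration using (elements; complete)

allFinEnumeration : ∀ n → Enumeration (Fin n)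
allFinEnumeration n = record
  { elements = allFin n ; unique = Unique.allFin⁺ n ; complete = ∈-allFin }

_×-enumeration_ : ∀ {A B} → Enumeration A → Enumeration B → Enumeration (A × B)
E ×-enumeration F = record
  { elements = cartesianProduct (elements E) (elements F)
  ; unique   = Unique.cartesianProduct⁺ (Enumeration.unique E) (Enumeration.unique F)
  ; complete = λ (a , b) → ∈-cartesianProduct⁺ (complete E a) (complete F b)
  }

maybe-enumeration : ∀ {A} → Enumeration A → Enumeration (Maybe A)
maybe-enumeration E = record
  { elements = nothing ∷ map just (elements E)
  ; unique   = All.map⁺ (All.universal (λ _ ()) (elements E))
             ∷ Unique.map⁺ just-injective (Enumeration.unique E)
  ; complete = λ { nothing → here refl ; (just a) → there (∈-map⁺ just (complete E a)) }
  }

module _ {A : Set} {P : A → Set} where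

  ExactlyOne-here : ∀ {x xs} → P x → All (¬_ ∘ P) xs → ExactlyOne P (x ∷ xs)
  ExactlyOne-here px none = zero , px , λ
    { zero    _   → refl
    ; (suc j) pxⱼ → ⊥-elim (All.lookup none (∈-lookup j) pxⱼ) }

  ExactlyOne-there : ∀ {x xs} → ¬ P x → ExactlyOne P xs → ExactlyOne P (x ∷ xs)
  ExactlyOne-there ¬px (i , pxᵢ , unique) = suc i , pxᵢ , λ
    { zero    px  → ⊥-elim (¬px px)
    ; (suc j) pxⱼ → cong suc (unique j pxⱼ) }

module _ {A B : Set} {P : B → Set} (f : A → B) where

  ExactlyOne-map⁺ : ∀ {xs a} → Unique xs → a ∈ xs → P (f a) → (∀ {b} → P (f b) → a ≡ b) →
                    ExactlyOne P (map f xs)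
  ExactlyOne-map⁺ (y≢ ∷ _) (here refl) pfa unique =
    ExactlyOne-here {P = P} pfa (All.map⁺ (All.map (λ a≢z pfz → a≢z (unique pfz)) y≢))
  ExactlyOne-map⁺ (y≢ ∷ u) (there a∈) pfa unique =
    ExactlyOne-there {P = P} (λ pfy → All.lookup y≢ a∈ (sym (unique pfy)))
                             (ExactlyOne-map⁺ u a∈ pfa unique)

  ExactlyOne-map : (E : Enumeration A) → ∃! _≡_ (P ∘ f) → ExactlyOne P (map f (elements E))
  ExactlyOne-map E (a , pfa , unique) = ExactlyOne-map⁺ (Enumeration.unique E) (complete E a) pfa unique

∃!-⇔ : ∀ {A : Set} {P Q : A → Set} → (∀ {a} → P a ⇔ Q a) → ∃! _≡_ Q → ∃! _≡_ P
∃!-⇔ P⇔Q (a , qa , unique) = a , Equivalence.from P⇔Q qa , unique ∘ Equivalence.to P⇔Q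

∃!? : ∀ {A : Set} {P : A → Set} → Enumeration A → DecidableEquality A → Decidable P → Dec (∃! _≡_ P)
∃!? {P = P} E _≟_ P? = map′ fromAny toAny (Any.any? isUnique? (elements E))
  where
  IsUnique : _ → Set
  IsUnique a = P a × All (λ b → P b → a ≡ b) (elements E)

  isUnique? : Decidable IsUnique
  isUnique? a = P? a ×-dec All.all? (λ b → P? b →-dec (a ≟ b)) (elements E)

  fromAny : Any.Any IsUnique (elements E) → ∃! _≡_ P
  fromAny any with Any.satisfied any
  ... | a , pa , unique = a , pa , λ {b} pb → All.lookup unique (complete E b) pb

  toAny : ∃! _≡_ P → Any.Any IsUnique (elements E)
  toAny (a , pa , unique) =
    Any.map (λ { refl → pa , All.universal (λ _ → unique) (elements E) }) (complete E a)

Triple : ℕ → Set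
Triple n = Fin 3 → Fin n

_∈ₜ_ : ∀ {n} → Fin n → Triple n → Set
x ∈ₜ t = ∃ λ e → x ≡ t e

tripleSum : ∀ {n} → Triple n → ℕ
tripleSum t = toℕ (t zero) + toℕ (t (suc zero)) + toℕ (t (suc (suc zero)))

_∈⟨_,_,_⟩ : ∀ {n} → Fin n → Fin n → Fin n → Fin n → Set
x ∈⟨ a , b , c ⟩ = x ≡ a ⊎ x ≡ b ⊎ x ≡ c

∈⟨⟩⇔∈ₜ : ∀ {n x} {t : Triple n} → x ∈⟨ t zero , t (suc zero) , t (suc (suc zero)) ⟩ ⇔ x ∈ₜ t
∈⟨⟩⇔∈ₜ = mk⇔
  (λ { (inj₁ p) → zero , p ; (inj₂ (inj₁ p)) → suc zero , p ; (inj₂ (inj₂ p)) → suc (suc zero) , p })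
  (λ { (zero , p) → inj₁ p ; (suc zero , p) → inj₂ (inj₁ p) ; (suc (suc zero) , p) → inj₂ (inj₂ p) })

module _ {n} {x a b c : Fin n} where

  ∈⟨⟩-swap₁₂ : x ∈⟨ a , b , c ⟩ → x ∈⟨ b , a , c ⟩
  ∈⟨⟩-swap₁₂ (inj₁ p)        = inj₂ (inj₁ p)
  ∈⟨⟩-swap₁₂ (inj₂ (inj₁ p)) = inj₁ p
  ∈⟨⟩-swap₁₂ (inj₂ (inj₂ p)) = inj₂ (inj₂ p)

  ∈⟨⟩-swap₂₃ : x ∈⟨ a , b , c ⟩ → x ∈⟨ a , c , b ⟩
  ∈⟨⟩-swap₂₃ = Sum.map₂ Sum.swap

record IsSortingOf {n} (B : Block n) (a b c : Fin n) : Set where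
  field
    members : ∀ {x} → x ∈B B ⇔ x ∈⟨ a , b , c ⟩
    sum     : blockSum B ≡ toℕ a + toℕ b + toℕ c
open IsSortingOf

module _ {n} {B : Block n} {a b c : Fin n} where

  isSortingOf-swap₁₂ : IsSortingOf B a b c → IsSortingOf B b a c
  isSortingOf-swap₁₂ s = record
    { members = mk⇔ (∈⟨⟩-swap₁₂ ∘ Equivalence.to (members s)) (Equivalence.from (members s) ∘ ∈⟨⟩-swap₁₂)
    ; sum     = trans (sum s) (xy∙z≈yx∙z (toℕ a) (toℕ b) (toℕ c))
    }

  isSortingOf-swap₂₃ : IsSortingOf B a b c → IsSortingOf B a c b
  isSortingOf-swap₂₃ s = record
    { members = mk⇔ (∈⟨⟩-swap₂₃ ∘ Equivalence.to (members s)) (Equivalence.from (members s) ∘ ∈⟨⟩-swap₂₃)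
    ; sum     = trans (sum s) (xy∙z≈xz∙y (toℕ a) (toℕ b) (toℕ c))
    }

isSortingOf-block : ∀ {n} {a b c : Fin n} (a<b : a < b) (b<c : b < c) →
                    IsSortingOf (block a b c a<b b<c) a b c
isSortingOf-block _ _ = record { members = mk⇔ id id ; sum = refl }

SortedBlock : ∀ {n} → Fin n → Fin n → Fin n → Set
SortedBlock a b c = Σ (Block _) λ B → IsSortingOf B a b c

sortedInsert : ∀ {n} (a b c : Fin n) → a < b → c ≢ a → c ≢ b → SortedBlock a b c
sortedInsert a b c a<b c≢a c≢b with <-cmp c a
... | tri< c<a _ _   =
  block c a b c<a a<b , isSortingOf-swap₂₃ (isSortingOf-swap₁₂ (isSortingOf-block c<a a<b))
... | tri≈ _ c≡a _   = ⊥-elim (c≢a c≡a)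
... | tri> _ _ a<c with <-cmp c b
...   | tri< c<b _ _ = block a c b a<c c<b , isSortingOf-swap₂₃ (isSortingOf-block a<c c<b)
...   | tri≈ _ c≡b _ = ⊥-elim (c≢b c≡b)
...   | tri> _ _ b<c = block a b c a<b b<c , isSortingOf-block a<b b<c

sortedTriple : ∀ {n} (a b c : Fin n) → a ≢ b → c ≢ a → c ≢ b → SortedBlock a b c
sortedTriple a b c a≢b c≢a c≢b with <-cmp a b
... | tri< a<b _ _ = sortedInsert a b c a<b c≢a c≢b
... | tri≈ _ a≡b _ = ⊥-elim (a≢b a≡b)
... | tri> _ _ b<a = map₂ isSortingOf-swap₁₂ (sortedInsert b a c b<a c≢b c≢a)

sortedTriple-injective : ∀ {n} (t : Triple n) → Injective _≡_ _≡_ t →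
                         SortedBlock (t zero) (t (suc zero)) (t (suc (suc zero)))
sortedTriple-injective t inj = sortedTriple _ _ _ ((λ ()) ∘ inj) ((λ ()) ∘ inj) ((λ ()) ∘ inj)

record KirkmanScheme (m : ℕ) : Set₁ where
  field
    Class            : Set
    classes          : Enumeration Class
    triple           : Class → Fin m → Triple (3 * m)
    triple-injective : ∀ c u → Injective _≡_ _≡_ (triple c u)
    classesPartition : ∀ c x → ∃! _≡_ λ u → x ∈ₜ triple c u
    pairsCoveredOnce : ∀ x y → x ≢ y →
                       ∃! _≡_ λ ((c , u) : Class × Fin m) → x ∈ₜ triple c u × y ∈ₜ triple c u
    minSum-lower     : ∀ c u → 3 * m ≤ tripleSum (triple c u)
    minSum-attained  : ∃₂ λ c u → tripleSum (triple c u) ≡ 3 * m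

map-uncurry-cartesianProduct : ∀ {A B C : Set} (f : A → B → C) xs ys →
  map (uncurry f) (cartesianProduct xs ys) ≡ concat (map (λ x → map (f x) ys) xs)
map-uncurry-cartesianProduct f []       ys = refl
map-uncurry-cartesianProduct f (x ∷ xs) ys = begin
  map (uncurry f) (map (x ,_) ys ++ cartesianProduct xs ys)
    ≡⟨ map-++ (uncurry f) (map (x ,_) ys) _ ⟩
  map (uncurry f) (map (x ,_) ys) ++ map (uncurry f) (cartesianProduct xs ys)
    ≡⟨ cong₂ _++_ (sym (map-∘ ys)) (map-uncurry-cartesianProduct f xs ys) ⟩
  map (f x) ys ++ concat (map (λ x → map (f x) ys) xs)
    ∎
  where open ≡-Reasoning

module KirkmanSystem {m} (S : KirkmanScheme m) where
  open KirkmanScheme S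

  sortedBlockOf : ∀ c u → SortedBlock _ _ _
  sortedBlockOf c u = sortedTriple-injective (triple c u) (triple-injective c u)

  blockOf : Class → Fin m → Block (3 * m)
  blockOf c u = proj₁ (sortedBlockOf c u)

  ∈B-blockOf : ∀ {x c u} → x ∈B blockOf c u ⇔ x ∈ₜ triple c u
  ∈B-blockOf {c = c} {u} = ∈⟨⟩⇔∈ₜ ⇔-∘ members (proj₂ (sortedBlockOf c u))

  blockSum-blockOf : ∀ c u → blockSum (blockOf c u) ≡ tripleSum (triple c u)
  blockSum-blockOf c u = sum (proj₂ (sortedBlockOf c u))

  parallelClass : Class → List (Block (3 * m))
  parallelClass c = map (blockOf c) (allFin m)

  cells : Enumeration (Class × Fin m)
  cells = classes ×-enumeration allFinEnumeration m

  blocks : List (Block (3 * m))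
  blocks = map (uncurry blockOf) (elements cells)

  resolution : List (List (Block (3 * m)))
  resolution = map parallelClass (elements classes)

  isSTS : IsSTS (3 * m) blocks
  isSTS x y x≢y = ExactlyOne-map {P = λ B → x ∈B B × y ∈B B} (uncurry blockOf) cells
    (∃!-⇔ (∈B-blockOf ×-⇔ ∈B-blockOf) (pairsCoveredOnce x y x≢y))

  isParallelClass : ∀ c → IsParallelClass (3 * m) (parallelClass c)
  isParallelClass c x = ExactlyOne-map {P = x ∈B_} (blockOf c) (allFinEnumeration m)
    (∃!-⇔ ∈B-blockOf (classesPartition c x))

  isResolvable : IsResolvable (3 * m) blocks
  isResolvable = resolution , ↭-reflexive concat-resolution , resolution-parallel
    where
    concat-resolution : concat resolution ≡ blocks
    concat-resolution = sym (map-uncurry-cartesianProduct blockOf (elements classes) (allFin m))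

    resolution-parallel : ∀ P → P ∈ resolution → IsParallelClass (3 * m) P
    resolution-parallel P P∈ with ∈-map⁻ parallelClass P∈
    ... | c , _ , refl = isParallelClass c

  isMinSum : IsMinSum blocks (3 * m)
  isMinSum = lower , attained minSum-attained
    where
    lower : ∀ B → B ∈ blocks → 3 * m ≤ blockSum B
    lower B B∈ with ∈-map⁻ (uncurry blockOf) B∈
    ... | (c , u) , _ , refl = ≤-trans (minSum-lower c u) (≤-reflexive (sym (blockSum-blockOf c u)))

    attained : ∃₂ (λ c u → tripleSum (triple c u) ≡ 3 * m) → ∃ λ B → B ∈ blocks × blockSum B ≡ 3 * m
    attained (c , u , sum≡) =
      blockOf c u , ∈-map⁺ (uncurry blockOf) (complete cells (c , u)) , trans (blockSum-blockOf c u) sum≡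

  kirkmanTripleSystem : Σ (List (Block (3 * m))) λ ℬ → IsKTS (3 * m) ℬ × IsMinSum ℬ (3 * m)
  kirkmanTripleSystem = blocks , (isSTS , isResolvable) , isMinSum

trivialScheme : KirkmanScheme 1
trivialScheme = record
  { Class            = Fin 1
  ; classes          = allFinEnumeration 1
  ; triple           = λ _ _ → id
  ; triple-injective = λ _ _ → id
  ; classesPartition = λ _ x → zero , (x , refl) , λ { {zero} _ → refl }
  ; pairsCoveredOnce = λ x y _ →
      (zero , zero) , ((x , refl) , (y , refl)) , λ { {zero , zero} _ → refl }
  ; minSum-lower     = λ _ _ → ≤-refl
  ; minSum-attained  = zero , zero , refl
  }

-- Affine in (s, j) with s-coefficient e, so two distinct positions give a uniquely solvable
-- linear system over ℤ/3; the three digits sum to 3(j + s) + 2 ≡ 2 (mod 3).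
topDigit : Fin 3 → Fin 3 → Fin 3 → Fin 3
topDigit e s j = (toℕ j + toℕ e * toℕ s + toℕ e * (toℕ e ∸ 1)) mod 3

opaque
  topDigit-solvable : ∀ e s i → ∃! _≡_ λ j → topDigit e s j ≡ i
  topDigit-solvable = toWitness {a? = all? λ e → all? λ s → all? λ i →
    ∃!? (allFinEnumeration 3) _≟_ λ j → topDigit e s j ≟ i} _

  topDigit-pair-solvable : ∀ e e′ → e ≢ e′ → ∀ i i′ →
    ∃! _≡_ λ ((s , j) : Fin 3 × Fin 3) → topDigit e s j ≡ i × topDigit e′ s j ≡ i′
  topDigit-pair-solvable = toWitness {a? = all? λ e → all? λ e′ → ¬? (e ≟ e′) →-dec
    all? λ i → all? λ i′ →
    ∃!? (allFinEnumeration 3 ×-enumeration allFinEnumeration 3) (≡-dec _≟_ _≟_)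
        λ (s , j) → (topDigit e s j ≟ i) ×-dec (topDigit e′ s j ≟ i′)} _

  2≤topDigitSum : ∀ s j → 2 ≤ tripleSum (λ e → topDigit e s j)
  2≤topDigitSum = toWitness {a? = all? λ s → all? λ j → 2 ≤? tripleSum (λ e → topDigit e s j)} _

data CombineView (k m : ℕ) : Fin (k * m) → Set where
  combined : (i : Fin k) (j : Fin m) → CombineView k m (combine i j)

combineView : ∀ {k} m (w : Fin (k * m)) → CombineView k m w
combineView {k} m w = subst (CombineView k m) (combine-remQuot {k} m w) (combined _ _)

combine-injective : ∀ {k m} (i : Fin k) (j : Fin m) i′ j′ →
                    combine i j ≡ combine i′ j′ → i ≡ i′ × j ≡ j′
combine-injective i j i′ j′ eq = combine-injectiveˡ i j i′ j′ eq , combine-injectiveʳ i j i′ j′ eq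

tripleSum-cong : ∀ {n} {t t′ : Triple n} → (∀ e → t e ≡ t′ e) → tripleSum t ≡ tripleSum t′
tripleSum-cong t≗t′ = cong₂ _+_ (cong₂ _+_ (cong toℕ (t≗t′ zero)) (cong toℕ (t≗t′ (suc zero))))
                                (cong toℕ (t≗t′ (suc (suc zero))))

tripleSum-combine : ∀ {n} (d : Triple 3) (t : Triple n) →
                    tripleSum (λ e → combine (d e) (t e)) ≡ n * tripleSum d + tripleSum t
tripleSum-combine {n} d t = begin
  tripleSum (λ e → combine (d e) (t e))
    ≡⟨ cong₂ _+_ (cong₂ _+_ (toℕ-combine (d zero) (t zero)) (toℕ-combine (d (suc zero)) (t (suc zero))))
                 (toℕ-combine (d (suc (suc zero))) (t (suc (suc zero)))) ⟩
  n * a₀ + b₀ + (n * a₁ + b₁) + (n * a₂ + b₂)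
    ≡⟨ regroup n a₀ a₁ a₂ b₀ b₁ b₂ ⟩
  n * (a₀ + a₁ + a₂) + (b₀ + b₁ + b₂)
    ∎
  where
  open ≡-Reasoning
  a₀ = toℕ (d zero) ; a₁ = toℕ (d (suc zero)) ; a₂ = toℕ (d (suc (suc zero)))
  b₀ = toℕ (t zero) ; b₁ = toℕ (t (suc zero)) ; b₂ = toℕ (t (suc (suc zero)))
  regroup : ∀ n a₀ a₁ a₂ b₀ b₁ b₂ →
            n * a₀ + b₀ + (n * a₁ + b₁) + (n * a₂ + b₂) ≡ n * (a₀ + a₁ + a₂) + (b₀ + b₁ + b₂)
  regroup = solve-∀

3*n≡n*2+n : ∀ n → 3 * n ≡ n * 2 + n
3*n≡n*2+n = solve-∀

module Lift {m} (S : KirkmanScheme m) where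
  open KirkmanScheme S

  shiftedTriple : Class → Fin 3 → Fin 3 × Fin m → Triple (3 * (3 * m))
  shiftedTriple c s (j , v) e = combine (topDigit e s j) (triple c v e)

  liftedTriple : Maybe (Class × Fin 3) → Fin (3 * m) → Triple (3 * (3 * m))
  liftedTriple nothing        u e = combine e u
  liftedTriple (just (c , s)) w   = shiftedTriple c s (remQuot m w)

  liftedTriple-combine : ∀ c s j v e →
    liftedTriple (just (c , s)) (combine j v) e ≡ combine (topDigit e s j) (triple c v e)
  liftedTriple-combine c s j v e = cong (λ jv → shiftedTriple c s jv e) (remQuot-combine j v)

  combine≡shifted⁻ : ∀ i x c s j v e → combine i x ≡ liftedTriple (just (c , s)) (combine j v) e →
                     i ≡ topDigit e s j × x ≡ triple c v e
  combine≡shifted⁻ i x c s j v e eq =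
    combine-injective i x (topDigit e s j) (triple c v e) (trans eq (liftedTriple-combine c s j v e))

  combine≡shifted⁺ : ∀ {i x} c s j v e → i ≡ topDigit e s j → x ≡ triple c v e →
                     combine i x ≡ liftedTriple (just (c , s)) (combine j v) e
  combine≡shifted⁺ c s j v e refl refl = sym (liftedTriple-combine c s j v e)

  liftedTriple-injective : ∀ c u → Injective _≡_ _≡_ (liftedTriple c u)
  liftedTriple-injective nothing u {e} {e′} eq = proj₁ (combine-injective e u e′ u eq)
  liftedTriple-injective (just (c , s)) w = shifted-injective (combineView m w)
    where
    shifted-injective : ∀ {w} → CombineView 3 m w → Injective _≡_ _≡_ (liftedTriple (just (c , s)) w)
    shifted-injective (combined j v) {e} {e′} eq = triple-injective c v (proj₂ (combine-injective
      (topDigit e s j) (triple c v e) (topDigit e′ s j) (triple c v e′) (begin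
      combine (topDigit e s j) (triple c v e)      ≡⟨ liftedTriple-combine c s j v e ⟨
      liftedTriple (just (c , s)) (combine j v) e  ≡⟨ eq ⟩
      liftedTriple (just (c , s)) (combine j v) e′ ≡⟨ liftedTriple-combine c s j v e′ ⟩
      combine (topDigit e′ s j) (triple c v e′)    ∎)))
      where open ≡-Reasoning

  columnPartition : ∀ i x → ∃! _≡_ λ u → combine i x ∈ₜ liftedTriple nothing u
  columnPartition i x = x , (i , refl) , λ {u} (e , eq) → proj₂ (combine-injective i x e u eq)

  shiftedClassPartition : ∀ c s i x → ∃! _≡_ λ u → combine i x ∈ₜ liftedTriple (just (c , s)) u
  shiftedClassPartition c s i x with classesPartition c x
  ... | v , (e₀ , x≡) , v-unique with topDigit-solvable e₀ s i
  ...   | j , digit≡ , j-unique =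
    combine j v , (e₀ , combine≡shifted⁺ c s j v e₀ (sym digit≡) x≡) , unique (combineView m _)
    where
    unique : ∀ {u} → CombineView 3 m u → combine i x ∈ₜ liftedTriple (just (c , s)) u → combine j v ≡ u
    unique (combined j′ v′) (e , eq) with combine≡shifted⁻ i x c s j′ v′ e eq
    ... | i≡ , x≡′ with v-unique (e , x≡′)
    ... | refl with triple-injective c v (trans (sym x≡) x≡′)
    ... | refl = cong (λ j → combine {3} j v) (j-unique {j′} (sym i≡))

  liftedClassesPartition : ∀ c p → ∃! _≡_ λ u → p ∈ₜ liftedTriple c u
  liftedClassesPartition c p = partition c (combineView (3 * m) p)
    where
    partition : ∀ c {p} → CombineView 3 (3 * m) p → ∃! _≡_ λ u → p ∈ₜ liftedTriple c u
    partition nothing        (combined i x) = columnPartition i x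
    partition (just (c , s)) (combined i x) = shiftedClassPartition c s i x

  LiftedPairCover : Fin (3 * (3 * m)) → Fin (3 * (3 * m)) → Maybe (Class × Fin 3) × Fin (3 * m) → Set
  LiftedPairCover p q (c , u) = p ∈ₜ liftedTriple c u × q ∈ₜ liftedTriple c u

  columnPairCoveredOnce : ∀ i i′ x → combine i x ≢ combine i′ x →
                          ∃! _≡_ (LiftedPairCover (combine i x) (combine i′ x))
  columnPairCoveredOnce i i′ x p≢q = (nothing , x) , ((i , refl) , (i′ , refl)) , unique
    where
    unique : ∀ {cu} → LiftedPairCover (combine i x) (combine i′ x) cu → (nothing , x) ≡ cu
    unique {nothing , u} ((e , eq) , _) = cong (nothing ,_) (proj₂ (combine-injective i x e u eq))
    unique {just (c , s) , w} = shifted (combineView m w)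
      where
      shifted : ∀ {w} → CombineView 3 m w →
                LiftedPairCover (combine i x) (combine i′ x) (just (c , s) , w) →
                (nothing , x) ≡ (just (c , s) , w)
      shifted (combined j v) ((e , eq) , (e′ , eq′))
        with combine≡shifted⁻ i x c s j v e eq | combine≡shifted⁻ i′ x c s j v e′ eq′
      ... | i≡ , x≡ | i′≡ , x≡′ with triple-injective c v (trans (sym x≡) x≡′)
      ... | refl = ⊥-elim (p≢q (cong (λ d → combine {3} d x) (trans i≡ (sym i′≡))))

  shiftedPairCoveredOnce : ∀ i i′ {x y} → x ≢ y →
                           ∃! _≡_ (LiftedPairCover (combine i x) (combine i′ y))
  shiftedPairCoveredOnce i i′ {x} {y} x≢y with pairsCoveredOnce x y x≢y
  ... | (c , v) , ((e₁ , x≡) , (e₂ , y≡)) , cv-unique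
    with topDigit-pair-solvable e₁ e₂ (λ { refl → x≢y (trans x≡ (sym y≡)) }) i i′
  ...   | (s , j) , (digit₁ , digit₂) , sj-unique =
    (just (c , s) , combine j v) ,
    ((e₁ , combine≡shifted⁺ c s j v e₁ (sym digit₁) x≡) ,
     (e₂ , combine≡shifted⁺ c s j v e₂ (sym digit₂) y≡)) ,
    unique
    where
    unique : ∀ {cu} → LiftedPairCover (combine i x) (combine i′ y) cu → (just (c , s) , combine j v) ≡ cu
    unique {nothing , u} ((e , eq) , (e′ , eq′)) =
      ⊥-elim (x≢y (trans (proj₂ (combine-injective i x e u eq))
                         (sym (proj₂ (combine-injective i′ y e′ u eq′)))))
    unique {just (c′ , s′) , w} = shifted (combineView m w)
      where
      shifted : ∀ {w} → CombineView 3 m w →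
                LiftedPairCover (combine i x) (combine i′ y) (just (c′ , s′) , w) →
                (just (c , s) , combine j v) ≡ (just (c′ , s′) , w)
      shifted (combined j′ v′) ((e , eq) , (e′ , eq′))
        with combine≡shifted⁻ i x c′ s′ j′ v′ e eq | combine≡shifted⁻ i′ y c′ s′ j′ v′ e′ eq′
      ... | i≡ , x≡′ | i′≡ , y≡′ with cv-unique ((e , x≡′) , (e′ , y≡′))
      ... | refl with triple-injective c v (trans (sym x≡) x≡′) | triple-injective c v (trans (sym y≡) y≡′)
      ... | refl | refl with sj-unique {s′ , j′} (sym i≡ , sym i′≡)
      ... | refl = refl

  liftedPairsCoveredOnce : ∀ p q → p ≢ q → ∃! _≡_ (LiftedPairCover p q)
  liftedPairsCoveredOnce p q = covered (combineView (3 * m) p) (combineView (3 * m) q)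
    where
    covered : ∀ {p q} → CombineView 3 (3 * m) p → CombineView 3 (3 * m) q → p ≢ q →
              ∃! _≡_ (LiftedPairCover p q)
    covered (combined i x) (combined i′ y) p≢q with x ≟ y
    ... | yes refl = columnPairCoveredOnce i i′ x p≢q
    ... | no x≢y   = shiftedPairCoveredOnce i i′ x≢y

  tripleSum-shifted : ∀ c s j v → tripleSum (liftedTriple (just (c , s)) (combine j v)) ≡
                      3 * m * tripleSum (λ e → topDigit e s j) + tripleSum (triple c v)
  tripleSum-shifted c s j v =
    trans (tripleSum-cong (liftedTriple-combine c s j v))
          (tripleSum-combine (λ e → topDigit e s j) (triple c v))

  liftedMinSum-lower : ∀ c u → 3 * (3 * m) ≤ tripleSum (liftedTriple c u)
  liftedMinSum-lower nothing u = begin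
    3 * (3 * m)                              ≡⟨ *-comm 3 (3 * m) ⟩
    3 * m * 3                                ≤⟨ m≤m+n (3 * m * 3) _ ⟩
    3 * m * 3 + tripleSum (λ _ → u)          ≡⟨ tripleSum-combine id (λ _ → u) ⟨
    tripleSum (liftedTriple nothing u)       ∎
    where open ≤-Reasoning
  liftedMinSum-lower (just (c , s)) w = shifted (combineView m w)
    where
    open ≤-Reasoning
    shifted : ∀ {w} → CombineView 3 m w → 3 * (3 * m) ≤ tripleSum (liftedTriple (just (c , s)) w)
    shifted (combined j v) = begin
      3 * (3 * m)
        ≡⟨ 3*n≡n*2+n (3 * m) ⟩
      3 * m * 2 + 3 * m
        ≤⟨ +-mono-≤ (*-monoʳ-≤ (3 * m) (2≤topDigitSum s j)) (minSum-lower c v) ⟩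
      3 * m * tripleSum (λ e → topDigit e s j) + tripleSum (triple c v)
        ≡⟨ tripleSum-shifted c s j v ⟨
      tripleSum (liftedTriple (just (c , s)) (combine j v))
        ∎

  liftedMinSum-attained : ∃₂ λ c u → tripleSum (liftedTriple c u) ≡ 3 * (3 * m)
  liftedMinSum-attained with minSum-attained
  ... | c , v , sum≡ = just (c , zero) , combine {3} zero v , (begin
    tripleSum (liftedTriple (just (c , zero)) (combine {3} zero v)) ≡⟨ tripleSum-shifted c zero zero v ⟩
    3 * m * 2 + tripleSum (triple c v)                              ≡⟨ cong (3 * m * 2 +_) sum≡ ⟩
    3 * m * 2 + 3 * m                                               ≡⟨ 3*n≡n*2+n (3 * m) ⟨
    3 * (3 * m)                                                     ∎)
    where open ≡-Reasoning

lift : ∀ {m} → KirkmanScheme m → KirkmanScheme (3 * m)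
lift S = record
  { Class            = Maybe (Class × Fin 3)
  ; classes          = maybe-enumeration (classes ×-enumeration allFinEnumeration 3)
  ; triple           = liftedTriple
  ; triple-injective = liftedTriple-injective
  ; classesPartition = liftedClassesPartition
  ; pairsCoveredOnce = liftedPairsCoveredOnce
  ; minSum-lower     = liftedMinSum-lower
  ; minSum-attained  = liftedMinSum-attained
  }
  where
  open KirkmanScheme S
  open Lift S

kirkmanScheme : ∀ k → KirkmanScheme (3 ^ k)
kirkmanScheme zero    = trivialScheme
kirkmanScheme (suc k) = lift (kirkmanScheme k)

mainTheorem2 : (k : ℕ) → 1 ≤ k →
    Σ (List (Block (3 ^ k))) λ ℬ → IsKTS (3 ^ k) ℬ × IsMinSum ℬ (3 ^ k)
mainTheorem2 (suc k) _ = KirkmanSystem.kirkmanTripleSystem (kirkmanScheme k)
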